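{- Let $H$ be a $2$-vertex-connected graph on $n$ vertices containing a vertex $v$ such that $H-v$ is rigid (has no non-trivial automorphism). Suppose one of the following holds: (1) there is no vertex $v'\in V(H)$, $v'\neq v$, that is similar or pseudosimilar to $v$; (2) all vertices $v^1,\dots,v^k$ ($k\ge 2$) that are similar or pseudosimilar to $v$ are twins of $v$. Then $H$ is reconstructible from its $(n-1)$-graphlet degree distribution. That is, every graph $H'$ on $n$ vertices whose $(n-1)$-graphlet degree distribution equals that of $H$ (for suitable orderings of the vertex sets) is isomorphic to $H$.
   Context: All graphs are finite, simple and undirected. Let $H$ be a graph on $n$ vertices. Two vertices $u,w$ of $H$ are twins if $N_H(u)=N_H(w)$. Vertices $u,w$ are similar if some automorphism of $H$ maps $u$ to $w$. They are pseudosimilar if they are not similar but $H-u\cong H-w$. A graphlet is a pair $(G,r)$ with $G$ a connected graph with at least one and fewer than $n$ vertices and $r\in V(G)$. Two graphlets are isomorphic if some isomorphism of the graphs maps root to root; graphlets are taken up to isomorphism in a fixed enumeration. For $v\in V(H)$, the graphlet degree of $v$ with respect to $(G,r)$ is the number of sets $S\subseteq V(H)$ with $v\in S$ such that some isomorphism $H[S]\to G$ maps $v$ to $r$. The $(n-1)$-graphlet degree distribution of $H$ is the matrix with rows indexed by the vertices of $H$ and columns by the graphlet classes with exactly $n-1$ vertices. Its entries are the corresponding graphlet degrees. -}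

module Defs where

open import Data.Bool using (Bool; true; false; _∧_; not)
open import Data.Nat using (ℕ; zero; suc; _≤_)
open import Data.Fin using (Fin; punchIn; _≟_)
open import Data.List using (List; []; _∷_; map; concatMap; filter; length; allFin)
open import Data.Bool.ListAction using (all; any)
open import Data.Vec using (Vec; lookup) renaming ([] to []ᵥ; _∷_ to _∷ᵥ_)
open import Data.Product using (Σ; _×_; _,_)
open import Function.Bundles using (_↔_; Inverse)
open import Relation.Nullary using (¬_)
open import Relation.Nullary.Decidable using (⌊_⌋)
open import Relation.Binary.PropositionalEquality using (_≡_; refl)
open import Data.Bool.Properties using () renaming (T? to T?)

record Graph (n : ℕ) : Set where
  field
    adj    : Fin n → Fin n → Bool
    sym    : ∀ i j → adj i j ≡ adj j i
    irrefl : ∀ i → adj i i ≡ false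
open Graph public

record Iso {m k : ℕ} (G : Graph m) (G' : Graph k) : Set where
  field
    to      : Fin m → Fin k
    from    : Fin k → Fin m
    from-to : ∀ i → from (to i) ≡ i
    to-from : ∀ j → to (from j) ≡ j
    pres    : ∀ i j → adj G' (to i) (to j) ≡ adj G i j
open Iso public

Aut : {n : ℕ} → Graph n → Set
Aut G = Iso G G

_-ᵥ_ : {m : ℕ} → Graph (suc m) → Fin (suc m) → Graph m
adj    (H -ᵥ v) i j = adj H (punchIn v i) (punchIn v j)
sym    (H -ᵥ v) i j = sym H (punchIn v i) (punchIn v j)
irrefl (H -ᵥ v) i   = irrefl H (punchIn v i)

Rigid : {n : ℕ} → Graph n → Set
Rigid G = (σ : Aut G) → ∀ i → to σ i ≡ i

Similar : {n : ℕ} → Graph n → Fin n → Fin n → Set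
Similar H u w = Σ (Aut H) λ σ → to σ u ≡ w

Pseudosimilar : {m : ℕ} → Graph (suc m) → Fin (suc m) → Fin (suc m) → Set
Pseudosimilar H u w = ¬ Similar H u w × Iso (H -ᵥ u) (H -ᵥ w)

Twins : {n : ℕ} → Graph n → Fin n → Fin n → Set
Twins H u w = ∀ x → adj H u x ≡ adj H w x

data Walk {n : ℕ} (G : Graph n) : Fin n → Fin n → Set where
  here : ∀ {i} → Walk G i i
  step : ∀ {i j k} → adj G i j ≡ true → Walk G j k → Walk G i k

Connected : {n : ℕ} → Graph n → Set
Connected G = ∀ i j → Walk G i j

TwoConnected : {m : ℕ} → Graph (suc m) → Set
TwoConnected {m} H = (3 ≤ suc m) × Connected H × (∀ x → Connected (H -ᵥ x))

_=ᶠ_ : {n : ℕ} → Fin n → Fin n → Bool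
a =ᶠ b = ⌊ a ≟ b ⌋

_=ᵇ_ : Bool → Bool → Bool
true  =ᵇ b = b
false =ᵇ b = not b

allVecs : {A : Set} → (k : ℕ) → List A → List (Vec A k)
allVecs zero    xs = []ᵥ ∷ []
allVecs (suc k) xs = concatMap (λ x → map (x ∷ᵥ_) (allVecs k xs)) xs

allSubsets : (n : ℕ) → List (Vec Bool n)
allSubsets n = allVecs n (true ∷ false ∷ [])

allMaps : (k n : ℕ) → List (Vec (Fin n) k)
allMaps k n = allVecs k (allFin n)

-- f : V(G) → V(H) is the inverse of an isomorphism H[S] → G, i.e.
-- f is injective, has image exactly S, and preserves adjacency and non-adjacency.
isoOnto : {n k : ℕ} (H : Graph n) (G : Graph k) → Vec (Fin n) k → Vec Bool n → Bool
isoOnto {n} {k} H G f S =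
  all (λ a → all (λ b → (lookup f a =ᶠ lookup f b) =ᵇ (a =ᶠ b)) (allFin k)) (allFin k)
  ∧ all (λ x → lookup S x =ᵇ any (λ a → lookup f a =ᶠ x) (allFin k)) (allFin n)
  ∧ all (λ a → all (λ b → adj G a b =ᵇ adj H (lookup f a) (lookup f b)) (allFin k)) (allFin k)

graphletSet : {n k : ℕ} (H : Graph n) (G : Graph k) (r : Fin k) (v : Fin n) → Vec Bool n → Bool
graphletSet {n} {k} H G r v S =
  lookup S v ∧ any (λ f → isoOnto H G f S ∧ (lookup f r =ᶠ v)) (allMaps k n)

gdeg : {n k : ℕ} (H : Graph n) (G : Graph k) (r : Fin k) (v : Fin n) → ℕ
gdeg {n} H G r v = length (filter (λ S → T? (graphletSet H G r v S)) (allSubsets n))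

-- H and H' (both on n = suc m vertices) have the same (n-1)-graphlet degree
-- distribution, for a suitable matching π of the rows: for every graphlet
-- (connected G on n-1 = m vertices, root r) the columns agree.
SameGDD : {m : ℕ} → Graph (suc m) → Graph (suc m) → Set
SameGDD {m} H H' =
  Σ (Fin (suc m) ↔ Fin (suc m)) λ π →
    (G : Graph m) → Connected G → (r : Fin m) → (x : Fin (suc m)) →
      gdeg H G r (Inverse.to π x) ≡ gdeg H' G r x

module Submission where

-- Let p be the row matching V(H') → V(H). A graphlet (G, r) on n-1 vertices has positive degree
-- at x iff some card K - u is isomorphic to G with r placed at x, so p transports rooted cards
-- between H and H' (every card of H is connected, H being 2-connected). The card H - v yields a
-- card H' - u' ≅ H - v, i.e. an embedding f of H - v into H' missing u'. Carried back, the rooted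
-- card (H' - u', s) gives a card H - u ≅ H - v, so u is a twin of v by hypothesis; the
-- transposition of v and u is an automorphism of H, and rigidity of H - v forces p (f s) to be
-- the image of s under it. Thus p (f s) is a twin of s (as a vertex of H) and p u' a twin of v,
-- and it remains to see that u' ~ f s iff v ~ s, i.e. that deg H' (f s) = deg H (p (f s)).
-- Counting degrees through the cards H - t shows deg H' x ≤ deg H (p x), and the converse unless
-- p x is adjacent to every other vertex. In that case take t not a twin of v (one exists since
-- H - p x has an edge): the card H' - y matching H - t has x ≁ y, which is impossible both for
-- y = u' (it would give H - t ≅ H - v) and for y = f s'.

open import Defs hiding (sym)
open import Data.Bool.Base using (Bool; true; false; T)
open import Data.Bool.Properties using (T-∧; T?) renaming (_≟_ to _≟ᵇ_)
open import Data.Bool.ListAction using (all; any)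
open import Data.Empty using (⊥)
open import Data.Fin.Base using (Fin; zero; suc; punchIn; punchOut)
open import Data.Fin.Permutation as Perm using (Permutation; permutation; _⟨$⟩ʳ_; _⟨$⟩ˡ_)
open import Data.Fin.Permutation.Components using (transpose; transpose-inverse)
open import Data.Fin.Properties
  using (_≟_; any?; all?; injective⇒≤; punchOut-injective; punchIn-punchOut; punchInᵢ≢i; punchIn-injective)
open import Data.List.Base using (List; []; _∷_; length; allFin)
open import Data.List.Membership.Propositional using (_∈_)
open import Data.List.Membership.Propositional.Properties
  using (∈-allFin; ∈-map⁺; ∈-concatMap⁺; ∈-filter⁺; ∈-filter⁻)
open import Data.List.Relation.Unary.All as All using ()
open import Data.List.Relation.Unary.All.Properties using (all⁺; all⁻)
open import Data.List.Relation.Unary.Any as Any using (here; there)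
open import Data.List.Relation.Unary.Any.Properties using (any⁺; any⁻)
open import Data.Nat.Base using (ℕ; zero; suc; _+_; _≤_; s≤s; z≤n)
open import Data.Nat.Properties
  using (+-0-commutativeMonoid; +-commutativeSemigroup; +-monoˡ-≤; m≤n+m; m≢1+n+m; 1+n≰n; suc-injective;
         module ≤-Reasoning)
open import Data.Product.Base using (Σ; ∃; _×_; _,_; proj₁; proj₂)
open import Data.Sum.Base using (_⊎_; inj₁; inj₂; [_,_]′)
open import Data.Vec.Base using (Vec; lookup; tabulate; []; _∷_)
open import Data.Vec.Properties using (lookup∘tabulate)
open import Function.Base using (id; _∘_)
open import Function.Bundles using (_⇔_; mk⇔; Equivalence; _↔_; Inverse)
open import Function.Definitions using (Injective)
open import Relation.Binary.Definitions using (Decidable)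
open import Relation.Binary.PropositionalEquality
  using (_≡_; _≢_; refl; sym; trans; cong; cong₂; subst; module ≡-Reasoning)
open import Relation.Nullary.Decidable
  using (yes; no; toWitness; fromWitness; ¬?; _×-dec_; decidable-stable; dec-true)
open import Relation.Nullary.Negation using (¬_; contradiction)

open import Algebra.Properties.CommutativeMonoid.Sum +-0-commutativeMonoid
  using (sum; sum-remove; sum-permute; sum-cong-≗)
open import Algebra.Properties.CommutativeSemigroup +-commutativeSemigroup using (x∙yz≈y∙xz)

T-=ᵇ : ∀ {a b} → T (a =ᵇ b) ⇔ a ≡ b
T-=ᵇ {true}  {true}  = mk⇔ (λ _ → refl) _
T-=ᵇ {true}  {false} = mk⇔ (λ ()) (λ ())
T-=ᵇ {false} {true}  = mk⇔ (λ ()) (λ ())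
T-=ᵇ {false} {false} = mk⇔ (λ _ → refl) _

T-=ᶠ : ∀ {n} {a b : Fin n} → T (a =ᶠ b) ⇔ a ≡ b
T-=ᶠ = mk⇔ toWitness fromWitness

T-ext : ∀ {a b} → (T a → T b) → (T b → T a) → a ≡ b
T-ext {true}  {true}  _ _ = refl
T-ext {true}  {false} f _ with () ← f _
T-ext {false} {true}  _ g with () ← g _
T-ext {false} {false} _ _ = refl

T-all-allFin : ∀ {n} {p : Fin n → Bool} → T (all p (allFin n)) ⇔ (∀ i → T (p i))
T-all-allFin {p = p} = mk⇔
  (λ t i → All.lookup (all⁺ p _ t) (∈-allFin i))
  (λ h → all⁻ p {allFin _} (All.tabulate (λ {i} _ → h i)))

T-all²-allFin : ∀ {n} {p : Fin n → Fin n → Bool} →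
                T (all (λ a → all (p a) (allFin n)) (allFin n)) ⇔ (∀ a b → T (p a b))
T-all²-allFin {n} = mk⇔
  (λ t a → Equivalence.to (T-all-allFin {n}) (Equivalence.to (T-all-allFin {n}) t a))
  (λ h → Equivalence.from (T-all-allFin {n}) (Equivalence.from (T-all-allFin {n}) ∘ h))

any-allFin⁺ : ∀ {n} {p : Fin n → Bool} i → T (p i) → T (any p (allFin n))
any-allFin⁺ {p = p} i t = any⁺ p (Any.map (λ { refl → t }) (∈-allFin i))

∈⇒1≤length : ∀ {A : Set} {x : A} {xs} → x ∈ xs → 1 ≤ length xs
∈⇒1≤length {xs = _ ∷ _} _ = s≤s z≤n

1≤length⇒∈ : ∀ {A : Set} {xs : List A} → 1 ≤ length xs → ∃ (_∈ xs)
1≤length⇒∈ {xs = x ∷ _} _ = x , here refl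

allVecs-complete : ∀ {A : Set} {k} (xs : List A) (w : Vec A k) →
                   (∀ i → lookup w i ∈ xs) → w ∈ allVecs k xs
allVecs-complete xs []      _ = here refl
allVecs-complete xs (x ∷ w) h =
  ∈-concatMap⁺ _ (Any.map (λ { refl → ∈-map⁺ (x ∷_) (allVecs-complete xs w (h ∘ suc)) }) (h zero))

record _↪_ {k n : ℕ} (G : Graph k) (K : Graph n) : Set where
  field
    embed     : Fin k → Fin n
    injective : Injective _≡_ _≡_ embed
    adj-embed : ∀ a b → adj K (embed a) (embed b) ≡ adj G a b
open _↪_ public

module _ {n k : ℕ} (K : Graph n) (G : Graph k) where

  T-isoOnto : ∀ f S → T (isoOnto K G f S) ⇔
    ( (∀ a b → (lookup f a =ᶠ lookup f b) ≡ (a =ᶠ b))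
    × (∀ z → lookup S z ≡ any (λ a → lookup f a =ᶠ z) (allFin k))
    × (∀ a b → adj G a b ≡ adj K (lookup f a) (lookup f b)))
  T-isoOnto f S = mk⇔
    (λ t → let injective-test , rest = Equivalence.to (T-∧ {all _ (allFin k)}) t
               image-test , adjacency-test = Equivalence.to (T-∧ {all _ (allFin n)}) rest
           in (λ a b → Equivalence.to T-=ᵇ (Equivalence.to (T-all²-allFin {k}) injective-test a b))
            , (λ z → Equivalence.to T-=ᵇ (Equivalence.to (T-all-allFin {n}) image-test z))
            , (λ a b → Equivalence.to T-=ᵇ (Equivalence.to (T-all²-allFin {k}) adjacency-test a b)))
    (λ (injective-eq , image-eq , adjacency-eq) → Equivalence.from (T-∧ {all _ (allFin k)})
      ( Equivalence.from (T-all²-allFin {k}) (λ a b → Equivalence.from T-=ᵇ (injective-eq a b))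
      , Equivalence.from (T-∧ {all _ (allFin n)})
        ( Equivalence.from (T-all-allFin {n}) (Equivalence.from T-=ᵇ ∘ image-eq)
        , Equivalence.from (T-all²-allFin {k}) (λ a b → Equivalence.from T-=ᵇ (adjacency-eq a b)))))

  isoOnto⇒↪ : ∀ f S → T (isoOnto K G f S) → G ↪ K
  isoOnto⇒↪ f S t = record { embed = lookup f ; injective = lookup-injective ; adj-embed = lookup-adj }
    where
    lookup-injective : Injective _≡_ _≡_ (lookup f)
    lookup-injective {a} {b} fa≡fb = Equivalence.to T-=ᶠ
      (subst T (proj₁ (Equivalence.to (T-isoOnto f S) t) a b) (Equivalence.from T-=ᶠ fa≡fb))
    lookup-adj : ∀ a b → adj K (lookup f a) (lookup f b) ≡ adj G a b
    lookup-adj a b = sym (proj₂ (proj₂ (Equivalence.to (T-isoOnto f S) t)) a b)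

  image : Vec (Fin n) k → Vec Bool n
  image f = tabulate (λ z → any (λ a → lookup f a =ᶠ z) (allFin k))

  isoOnto-image : ∀ f → Injective _≡_ _≡_ (lookup f) →
                  (∀ a b → adj K (lookup f a) (lookup f b) ≡ adj G a b) →
                  T (isoOnto K G f (image f))
  isoOnto-image f f-injective f-adj =
    Equivalence.from (T-isoOnto f (image f)) (=ᶠ-lookup , lookup∘tabulate _ , λ a b → sym (f-adj a b))
    where
    =ᶠ-lookup : ∀ a b → (lookup f a =ᶠ lookup f b) ≡ (a =ᶠ b)
    =ᶠ-lookup a b = T-ext (Equivalence.from T-=ᶠ ∘ f-injective ∘ Equivalence.to T-=ᶠ)
                          (Equivalence.from T-=ᶠ ∘ cong (lookup f) ∘ Equivalence.to T-=ᶠ)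

  gdeg-pos⇒↪ : ∀ r x → 1 ≤ gdeg K G r x → Σ (G ↪ K) λ e → embed e r ≡ x
  gdeg-pos⇒↪ r x pos with S , S∈ ← 1≤length⇒∈ pos
    with f , t ← Any.satisfied (any⁻ _ (allMaps k n) (proj₂ (Equivalence.to T-∧
                   (proj₂ (∈-filter⁻ (T? ∘ graphletSet K G r x) {xs = allSubsets n} S∈)))))
    with iso , root ← Equivalence.to T-∧ t
    = isoOnto⇒↪ f S iso , Equivalence.to T-=ᶠ root

  ↪⇒gdeg-pos : ∀ (e : G ↪ K) r → 1 ≤ gdeg K G r (embed e r)
  ↪⇒gdeg-pos e r = ∈⇒1≤length (∈-filter⁺ _ (allVecs-complete _ S (λ _ → ∈-bool _)) selected)
    where
    f : Vec (Fin n) k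
    f = tabulate (embed e)
    S : Vec Bool n
    S = image f
    lookup-f : ∀ a → lookup f a ≡ embed e a
    lookup-f = lookup∘tabulate (embed e)
    f-injective : Injective _≡_ _≡_ (lookup f)
    f-injective {a} {b} eq = injective e (trans (sym (lookup-f a)) (trans eq (lookup-f b)))
    f-adj : ∀ a b → adj K (lookup f a) (lookup f b) ≡ adj G a b
    f-adj a b rewrite lookup-f a | lookup-f b = adj-embed e a b
    ∈-bool : ∀ b → b ∈ true ∷ false ∷ []
    ∈-bool true  = here refl
    ∈-bool false = there (here refl)
    root : T (lookup f r =ᶠ embed e r)
    root = Equivalence.from T-=ᶠ (lookup-f r)
    selected : T (graphletSet K G r (embed e r) S)
    selected = Equivalence.from T-∧
      ( subst T (sym (lookup∘tabulate _ (embed e r))) (any-allFin⁺ r root)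
      , any⁺ _ (Any.map (λ { refl → Equivalence.from T-∧ (isoOnto-image f f-injective f-adj , root) })
                        (allVecs-complete _ f (λ _ → ∈-allFin _))))

-- Cards

injective⇒surjective : ∀ {n} {f : Fin n → Fin n} → Injective _≡_ _≡_ f → ∀ y → ∃ λ x → f x ≡ y
injective⇒surjective {suc n} {f} f-injective y with any? (λ x → f x ≟ y)
... | yes hit = hit
... | no miss = contradiction (injective⇒≤ punchOut∘f-injective) 1+n≰n
  where
  y≢f : ∀ x → y ≢ f x
  y≢f x y≡fx = miss (x , sym y≡fx)
  punchOut∘f-injective : Injective _≡_ _≡_ (λ x → punchOut (y≢f x))
  punchOut∘f-injective = f-injective ∘ punchOut-injective (y≢f _) (y≢f _)

injective⇒misses : ∀ {m} {g : Fin m → Fin (suc m)} → Injective _≡_ _≡_ g → ∃ λ u → ∀ a → g a ≢ u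
injective⇒misses {m} {g} g-injective with any? (λ u → all? (λ a → ¬? (g a ≟ u)))
... | yes missed = missed
... | no ¬missed = contradiction (injective⇒≤ preimage-injective) 1+n≰n
  where
  preimage : ∀ u → ∃ λ a → g a ≡ u
  preimage u = decidable-stable (any? λ a → g a ≟ u)
    (λ ¬preimage → ¬missed (u , λ a gau → ¬preimage (a , gau)))
  preimage-injective : Injective _≡_ _≡_ (proj₁ ∘ preimage)
  preimage-injective {u} {w} eq = trans (sym (proj₂ (preimage u))) (trans (cong g eq) (proj₂ (preimage w)))

Iso-refl : ∀ {n} {G : Graph n} → Iso G G
Iso-refl = record { to = id ; from = id ; from-to = λ _ → refl ; to-from = λ _ → refl ; pres = λ _ _ → refl }

Iso-sym : ∀ {m n} {G : Graph m} {G' : Graph n} → Iso G G' → Iso G' G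
Iso-sym {G' = G'} I = record
  { to = from I ; from = to I ; from-to = to-from I ; to-from = from-to I
  ; pres = λ i j → trans (sym (pres I (from I i) (from I j))) (cong₂ (adj G') (to-from I i) (to-from I j))
  }

Iso-trans : ∀ {a b c} {G₁ : Graph a} {G₂ : Graph b} {G₃ : Graph c} → Iso G₁ G₂ → Iso G₂ G₃ → Iso G₁ G₃
Iso-trans I J = record
  { to = to J ∘ to I ; from = from I ∘ from J
  ; from-to = λ i → trans (cong (from I) (from-to J (to I i))) (from-to I i)
  ; to-from = λ j → trans (cong (to J) (to-from I (from J j))) (to-from J j)
  ; pres = λ i j → trans (pres J (to I i) (to I j)) (pres I i j)
  }

↔⇒Iso : ∀ {n} {G G' : Graph n} (π : Fin n ↔ Fin n) →
        (∀ a b → adj G (Inverse.to π a) (Inverse.to π b) ≡ adj G' a b) → Iso G' G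
↔⇒Iso π π-adj = record
  { to = Inverse.to π ; from = Inverse.from π
  ; from-to = Inverse.strictlyInverseʳ π ; to-from = Inverse.strictlyInverseˡ π
  ; pres = π-adj
  }

Iso⇒Permutation : ∀ {m n} {G : Graph m} {G' : Graph n} → Iso G G' → Permutation m n
Iso⇒Permutation I = permutation (to I) (from I) (to-from I) (from-to I)

Iso-remove : ∀ {m n} {K : Graph (suc m)} {K' : Graph (suc n)} (σ : Iso K K') {u w} →
             to σ u ≡ w → Iso (K -ᵥ u) (K' -ᵥ w)
Iso-remove {m} {n} {K' = K'} σ {u} refl = record
  { to = ρ ⟨$⟩ʳ_ ; from = ρ ⟨$⟩ˡ_
  ; from-to = λ _ → Perm.inverseˡ ρ ; to-from = λ _ → Perm.inverseʳ ρ
  ; pres = λ a b → trans (sym (cong₂ (adj K') (punchIn-permute a) (punchIn-permute b))) (pres σ _ _)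
  }
  where
  ρ : Permutation m n
  ρ = Perm.remove u (Iso⇒Permutation σ)
  punchIn-permute : ∀ a → to σ (punchIn u a) ≡ punchIn (to σ u) (ρ ⟨$⟩ʳ a)
  punchIn-permute = Perm.punchIn-permute (Iso⇒Permutation σ) u

Iso-remove-punchIn : ∀ {m n} {K : Graph (suc m)} {K' : Graph (suc n)} (σ : Iso K K') {u w}
                     (σu≡w : to σ u ≡ w) a → punchIn w (to (Iso-remove σ σu≡w) a) ≡ to σ (punchIn u a)
Iso-remove-punchIn σ {u} refl a = sym (Perm.punchIn-permute (Iso⇒Permutation σ) u a)

record Card {m : ℕ} (K : Graph (suc m)) (G : Graph m) (r : Fin m) (x : Fin (suc m)) : Set where
  field
    deleted : Fin (suc m)
    iso     : Iso G (K -ᵥ deleted)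
    root    : punchIn deleted (to iso r) ≡ x
open Card public

module _ {m : ℕ} {K : Graph (suc m)} where

  Card-self : ∀ u r → Card K (K -ᵥ u) r (punchIn u r)
  Card-self u r = record { deleted = u ; iso = Iso-refl ; root = refl }

  Card-deleted≢root : ∀ {G r x} (c : Card K G r x) → deleted c ≢ x
  Card-deleted≢root c u≡x = punchInᵢ≢i (deleted c) (to (iso c) _) (trans (root c) (sym u≡x))

  Card⇒↪ : ∀ {G r x} → Card K G r x → Σ (G ↪ K) λ e → embed e r ≡ x
  Card⇒↪ c = record
    { embed = punchIn (deleted c) ∘ to (iso c)
    ; injective = λ eq → trans (sym (from-to (iso c) _))
        (trans (cong (from (iso c)) (punchIn-injective (deleted c) _ _ eq)) (from-to (iso c) _))
    ; adj-embed = pres (iso c)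
    } , root c

  ↪⇒Card : ∀ {G} (e : G ↪ K) r → Card K G r (embed e r)
  ↪⇒Card {G} e r = record { deleted = u ; iso = φ-iso ; root = punchIn-punchOut (u≢ r) }
    where
    u : Fin (suc m)
    u = proj₁ (injective⇒misses (injective e))
    u≢ : ∀ a → u ≢ embed e a
    u≢ a = proj₂ (injective⇒misses (injective e)) a ∘ sym
    φ : Fin m → Fin m
    φ a = punchOut (u≢ a)
    φ-injective : Injective _≡_ _≡_ φ
    φ-injective = injective e ∘ punchOut-injective (u≢ _) (u≢ _)
    φ-iso : Iso G (K -ᵥ u)
    φ-iso = record
      { to = φ ; from = proj₁ ∘ injective⇒surjective φ-injective
      ; from-to = λ a → φ-injective (proj₂ (injective⇒surjective φ-injective (φ a)))
      ; to-from = proj₂ ∘ injective⇒surjective φ-injective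
      ; pres = λ a b → trans (cong₂ (adj K) (punchIn-punchOut (u≢ a)) (punchIn-punchOut (u≢ b))) (adj-embed e a b)
      }

  -- Opaque: the card is extracted from exhaustive enumerations, which must never be unfolded.
  opaque
    gdeg-pos⇔Card : ∀ {G r x} → 1 ≤ gdeg K G r x ⇔ Card K G r x
    gdeg-pos⇔Card {G} {r} = mk⇔
      (λ pos → let e , er≡x = gdeg-pos⇒↪ K G r _ pos in subst (Card K G r) er≡x (↪⇒Card e r))
      (λ c → let e , er≡x = Card⇒↪ c in subst (λ x → 1 ≤ gdeg K G r x) er≡x (↪⇒gdeg-pos K G e r))

-- Degrees and twins

toℕ : Bool → ℕ
toℕ false = 0
toℕ true  = 1

toℕ≤1 : ∀ b → toℕ b ≤ 1
toℕ≤1 false = z≤n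
toℕ≤1 true  = s≤s z≤n

toℕ+n≡n⇒false : ∀ b {n} → toℕ b + n ≡ n → b ≡ false
toℕ+n≡n⇒false false     _  = refl
toℕ+n≡n⇒false true  {n} eq = contradiction (sym eq) (m≢1+n+m n)

deg : ∀ {n} → Graph n → Fin n → ℕ
deg K x = sum (toℕ ∘ adj K x)

deg-remove : ∀ {m} (K : Graph (suc m)) {u x} (u≢x : u ≢ x) →
             deg K x ≡ toℕ (adj K x u) + deg (K -ᵥ u) (punchOut u≢x)
deg-remove K {u} {x} u≢x = trans (sum-remove {i = u} (toℕ ∘ adj K x))
  (cong (toℕ (adj K x u) +_) (sum-cong-≗ λ j → cong (λ y → toℕ (adj K y (punchIn u j))) (sym (punchIn-punchOut u≢x))))

deg-Iso : ∀ {n} {G G' : Graph n} (I : Iso G G') a → deg G' (to I a) ≡ deg G a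
deg-Iso {G' = G'} I a = trans (sum-permute (toℕ ∘ adj G' (to I a)) (Iso⇒Permutation I))
                               (sum-cong-≗ λ b → cong toℕ (pres I a b))

Card-deg : ∀ {m} {K : Graph (suc m)} {G r x} (c : Card K G r x) → deg K x ≡ toℕ (adj K x (deleted c)) + deg G r
Card-deg {m} {K} {G} {r} {x} c = begin
  deg K x                                         ≡⟨ deg-remove K u≢x ⟩
  toℕ (adj K x u) + deg (K -ᵥ u) (punchOut u≢x)   ≡⟨ cong (λ y → toℕ (adj K x u) + deg (K -ᵥ u) y) punchOut≡ ⟩
  toℕ (adj K x u) + deg (K -ᵥ u) (to (iso c) r)   ≡⟨ cong (toℕ (adj K x u) +_) (deg-Iso (iso c) r) ⟩
  toℕ (adj K x u) + deg G r                       ∎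
  where
  open ≡-Reasoning
  u : Fin (suc m)
  u = deleted c
  u≢x : u ≢ x
  u≢x = Card-deleted≢root c
  punchOut≡ : punchOut u≢x ≡ to (iso c) r
  punchOut≡ = punchIn-injective u _ _ (trans (punchIn-punchOut u≢x) (sym (root c)))

Walk⇒neighbour : ∀ {n} {K : Graph n} {a b} → Walk K a b → a ≢ b → ∃ λ t → adj K a t ≡ true
Walk⇒neighbour here       a≢a = contradiction refl a≢a
Walk⇒neighbour (step e _) _   = _ , e

transpose-left : ∀ {n} (i j : Fin n) → transpose i j i ≡ j
transpose-left i j rewrite dec-true (i ≟ i) refl = refl

module _ {n : ℕ} (K : Graph n) where

  Twins-sym : ∀ {a b} → Twins K a b → Twins K b a
  Twins-sym t x = sym (t x)

  Twins? : Decidable (Twins K)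
  Twins? a b = all? λ x → adj K a x ≟ᵇ adj K b x

  adj-Twins : ∀ {a a' c c'} → Twins K a a' → Twins K c c' → adj K a c ≡ adj K a' c'
  adj-Twins {a' = a'} {c} {c'} ta tc =
    trans (ta c) (trans (Graph.sym K a' c) (trans (tc a') (Graph.sym K c' a')))

  deg-Twins : ∀ {a b} → Twins K a b → deg K a ≡ deg K b
  deg-Twins t = sum-cong-≗ (cong toℕ ∘ t)

  edge⇒non-twin : ∀ {v a b} → adj K a b ≡ true → ¬ Twins K v a ⊎ ¬ Twins K v b
  edge⇒non-twin {v} ab with Twins? v _
  ... | no ¬ta = inj₁ ¬ta
  ... | yes ta = inj₂ λ tb → contradiction
          (trans (sym ab) (trans (sym (adj-Twins ta tb)) (irrefl K v))) λ ()

  universal⊎non-neighbour : ∀ x → (∀ t → t ≢ x → adj K x t ≡ true) ⊎ ∃ λ t → t ≢ x × adj K x t ≡ false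
  universal⊎non-neighbour x with any? (λ t → ¬? (t ≟ x) ×-dec (adj K x t ≟ᵇ false))
  ... | yes non-neighbour = inj₂ non-neighbour
  ... | no ¬non-neighbour = inj₁ universal
    where
    universal : ∀ t → t ≢ x → adj K x t ≡ true
    universal t t≢x with adj K x t in e
    ... | true  = refl
    ... | false = contradiction (t , t≢x , e) ¬non-neighbour

  Twins-transpose : ∀ {v u} → Twins K v u → ∀ c → Twins K c (transpose v u c)
  Twins-transpose {v} {u} t c with c ≟ v
  ... | yes refl = t
  ... | no _ with c ≟ u
  ...   | yes refl = Twins-sym t
  ...   | no _     = λ _ → refl

  transpose-non-twin : ∀ {v u c} → Twins K v u → ¬ Twins K v c → transpose v u c ≡ c
  transpose-non-twin {v} {u} {c} t ¬tc with c ≟ v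
  ... | yes refl = contradiction (λ _ → refl) ¬tc
  ... | no _ with c ≟ u
  ...   | yes refl = contradiction t ¬tc
  ...   | no _     = refl

  transpose-Aut : ∀ {v u} → Twins K v u → Aut K
  transpose-Aut {v} {u} t = record
    { to = transpose v u ; from = transpose u v
    ; from-to = λ _ → transpose-inverse u v ; to-from = λ _ → transpose-inverse v u
    ; pres = λ a b → sym (adj-Twins (Twins-transpose t a) (Twins-transpose t b))
    }

non-twin-avoiding : ∀ {k} (K : Graph (3 + k)) v z → Connected (K -ᵥ z) → ∃ λ t → t ≢ z × ¬ Twins K v t
non-twin-avoiding K v z K-z-connected
  with t , edge ← Walk⇒neighbour (K-z-connected zero (suc zero)) (λ ())
  with edge⇒non-twin K {v} edge
... | inj₁ ¬twin = punchIn z zero , punchInᵢ≢i z zero , ¬twin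
... | inj₂ ¬twin = punchIn z t , punchInᵢ≢i z t , ¬twin

module Reconstruction {k : ℕ} (H H' : Graph (3 + k)) (v : Fin (3 + k))
  (H-connected : Connected H) (H-cards-connected : ∀ x → Connected (H -ᵥ x))
  (H-v-rigid : Rigid (H -ᵥ v))
  (card-twin : ∀ t → Iso (H -ᵥ v) (H -ᵥ t) → Twins H v t)
  (π : Fin (3 + k) ↔ Fin (3 + k))
  (same-gdeg : (G : Graph (2 + k)) → Connected G → ∀ r x → gdeg H G r (Inverse.to π x) ≡ gdeg H' G r x)
  where

  p : Fin (3 + k) → Fin (3 + k)
  p = Inverse.to π

  p-injective : Injective _≡_ _≡_ p
  p-injective {a} {b} eq = trans (sym (Inverse.strictlyInverseʳ π a))
    (trans (cong (Inverse.from π) eq) (Inverse.strictlyInverseʳ π b))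

  -- Opaque for the same reason as gdeg-pos⇔Card.
  opaque
    Card-transfer : ∀ {G} → Connected G → ∀ {r x} → Card H G r (p x) → Card H' G r x
    Card-transfer {G} G-connected {r} {x} =
      Equivalence.to gdeg-pos⇔Card ∘ subst (1 ≤_) (same-gdeg G G-connected r x) ∘ Equivalence.from gdeg-pos⇔Card

    Card-transfer⁻ : ∀ {G} → Connected G → ∀ {r x} → Card H' G r x → Card H G r (p x)
    Card-transfer⁻ {G} G-connected {r} {x} =
      Equivalence.to gdeg-pos⇔Card ∘ subst (1 ≤_) (sym (same-gdeg G G-connected r x)) ∘ Equivalence.from gdeg-pos⇔Card

  G₀ : Graph (2 + k)
  G₀ = H -ᵥ v

  c₀ : Card H' G₀ zero (Inverse.from π (punchIn v zero))
  c₀ = Card-transfer (H-cards-connected v)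
    (subst (Card H G₀ zero) (sym (Inverse.strictlyInverseˡ π _)) (Card-self v zero))

  u' : Fin (3 + k)
  u' = deleted c₀

  f : Fin (2 + k) → Fin (3 + k)
  f s = punchIn u' (to (iso c₀) s)

  f-Card : ∀ s → Card H' G₀ s (f s)
  f-Card s = record { deleted = u' ; iso = iso c₀ ; root = refl }

  f⊎u' : ∀ x → x ≡ u' ⊎ ∃ λ s → f s ≡ x
  f⊎u' x with x ≟ u'
  ... | yes x≡u' = inj₁ x≡u'
  ... | no  x≢u' = inj₂ (from (iso c₀) (punchOut u'≢x)
                        , trans (cong (punchIn u') (to-from (iso c₀) _)) (punchIn-punchOut u'≢x))
    where
    u'≢x : u' ≢ x
    u'≢x = x≢u' ∘ sym

  p∘f-transposed : ∀ s → ∃ λ u → Twins H v u × p (f s) ≡ transpose v u (punchIn v s)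
  p∘f-transposed s = u , twin , (begin
      p (f s)                                   ≡⟨ sym (transpose-inverse v u) ⟩
      transpose v u (transpose u v (p (f s)))   ≡⟨ cong (transpose v u) transposed ⟩
      transpose v u (punchIn v s)               ∎)
    where
    open ≡-Reasoning
    c : Card H G₀ s (p (f s))
    c = Card-transfer⁻ (H-cards-connected v) (f-Card s)
    u : Fin (3 + k)
    u = deleted c
    twin : Twins H v u
    twin = card-twin u (iso c)
    σ : Aut H
    σ = transpose-Aut H (Twins-sym H twin)
    ρ : Iso (H -ᵥ u) (H -ᵥ v)
    ρ = Iso-remove σ {u} {v} (transpose-left u v)
    transposed : transpose u v (p (f s)) ≡ punchIn v s
    transposed = begin
      transpose u v (p (f s))                    ≡⟨ cong (transpose u v) (sym (root c)) ⟩
      transpose u v (punchIn u (to (iso c) s))   ≡⟨ sym (Iso-remove-punchIn σ {u} {v} (transpose-left u v) (to (iso c) s)) ⟩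
      punchIn v (to ρ (to (iso c) s))            ≡⟨ cong (punchIn v) (H-v-rigid (Iso-trans (iso c) ρ) s) ⟩
      punchIn v s                                ∎

  p∘f-twin : ∀ s → Twins H (punchIn v s) (p (f s))
  p∘f-twin s with _ , twin , eq ← p∘f-transposed s =
    subst (Twins H (punchIn v s)) (sym eq) (Twins-transpose H twin (punchIn v s))

  p∘f-fixes : ∀ s → ¬ Twins H v (punchIn v s) → p (f s) ≡ punchIn v s
  p∘f-fixes s ¬twin with _ , twin , eq ← p∘f-transposed s = trans eq (transpose-non-twin H twin ¬twin)

  p-u'-twin : Twins H v (p u')
  p-u'-twin = decidable-stable (Twins? H v (p u')) ¬¬twin
    where
    ¬¬twin : ¬ ¬ Twins H v (p u')
    ¬¬twin ¬twin = punchInᵢ≢i u' (to (iso c₀) s) (p-injective (trans (p∘f-fixes s ¬twin-s) w≡pu'))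
      where
      v≢pu' : v ≢ p u'
      v≢pu' v≡pu' = ¬twin (subst (Twins H v) v≡pu' λ _ → refl)
      s : Fin (2 + k)
      s = punchOut v≢pu'
      w≡pu' : punchIn v s ≡ p u'
      w≡pu' = punchIn-punchOut v≢pu'
      ¬twin-s : ¬ Twins H v (punchIn v s)
      ¬twin-s = subst (λ z → ¬ Twins H v z) (sym w≡pu') ¬twin

  adj-p∘f : ∀ r s → adj H (p (f r)) (p (f s)) ≡ adj H' (f r) (f s)
  adj-p∘f r s = trans (sym (adj-Twins H (p∘f-twin r) (p∘f-twin s))) (sym (pres (iso c₀) r s))

  Card-of-H-ᵥ : ∀ {x t} (t≢px : t ≢ p x) → Card H' (H -ᵥ t) (punchOut t≢px) x
  Card-of-H-ᵥ t≢px = Card-transfer (H-cards-connected _)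
    (subst (Card H _ _) (punchIn-punchOut t≢px) (Card-self _ _))

  deg-H'≤deg-H : ∀ x → deg H' x ≤ deg H (p x)
  deg-H'≤deg-H x
    with t , px~t ← Walk⇒neighbour (H-connected (p x) (punchIn (p x) zero)) (punchInᵢ≢i _ _ ∘ sym) = begin
      deg H' x                             ≡⟨ Card-deg c ⟩
      toℕ (adj H' x (deleted c)) + D       ≤⟨ +-monoˡ-≤ D (toℕ≤1 (adj H' x (deleted c))) ⟩
      toℕ true + D                         ≡⟨ cong (λ b → toℕ b + D) px~t ⟨
      toℕ (adj H (p x) t) + D              ≡⟨ deg-remove H t≢px ⟨
      deg H (p x)                          ∎
    where
    open ≤-Reasoning
    t≢px : t ≢ p x
    t≢px t≡px = contradiction (trans (sym px~t) (trans (cong (adj H (p x)) t≡px) (irrefl H (p x)))) λ ()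
    c : Card H' (H -ᵥ t) (punchOut t≢px) x
    c = Card-of-H-ᵥ t≢px
    D : ℕ
    D = deg (H -ᵥ t) (punchOut t≢px)

  deg-H≤deg-H' : ∀ {x t} (t≢px : t ≢ p x) → adj H (p x) t ≡ false → deg H (p x) ≤ deg H' x
  deg-H≤deg-H' {x} {t} t≢px px≁t = begin
      deg H (p x)                          ≡⟨ deg-remove H t≢px ⟩
      toℕ (adj H (p x) t) + D              ≡⟨ cong (λ b → toℕ b + D) px≁t ⟩
      D                                    ≤⟨ m≤n+m D (toℕ (adj H' x (deleted c))) ⟩
      toℕ (adj H' x (deleted c)) + D       ≡⟨ Card-deg c ⟨
      deg H' x                             ∎
    where
    open ≤-Reasoning
    c : Card H' (H -ᵥ t) (punchOut t≢px) x
    c = Card-of-H-ᵥ t≢px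
    D : ℕ
    D = deg (H -ᵥ t) (punchOut t≢px)

  deficit⇒non-adjacent : ∀ {x t} (t≢px : t ≢ p x) → adj H (p x) t ≡ true →
    deg H (p x) ≡ suc (deg H' x) → adj H' x (deleted (Card-of-H-ᵥ t≢px)) ≡ false
  deficit⇒non-adjacent {x} {t} t≢px px~t deficit = toℕ+n≡n⇒false _ (suc-injective (begin
      suc (toℕ (adj H' x (deleted c)) + D)  ≡⟨ cong suc (Card-deg c) ⟨
      suc (deg H' x)                       ≡⟨ deficit ⟨
      deg H (p x)                          ≡⟨ deg-remove H t≢px ⟩
      toℕ (adj H (p x) t) + D              ≡⟨ cong (λ b → toℕ b + D) px~t ⟩
      suc D                                ∎))
    where
    open ≡-Reasoning
    c : Card H' (H -ᵥ t) (punchOut t≢px) x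
    c = Card-of-H-ᵥ t≢px
    D : ℕ
    D = deg (H -ᵥ t) (punchOut t≢px)

  universal⇒¬deficit : ∀ s {t} (t≢px : t ≢ p (f s)) → ¬ Twins H v t →
    (∀ z → z ≢ p (f s) → adj H (p (f s)) z ≡ true) → deg H (p (f s)) ≢ suc (deg H' (f s))
  universal⇒¬deficit s {t} t≢px ¬twin universal deficit = by-cases (f⊎u' (deleted c))
    where
    open ≡-Reasoning
    c : Card H' (H -ᵥ t) (punchOut t≢px) (f s)
    c = Card-of-H-ᵥ t≢px
    by-cases : deleted c ≡ u' ⊎ ∃ (λ s' → f s' ≡ deleted c) → ⊥
    by-cases (inj₁ y≡u') =
      ¬twin (card-twin t (Iso-trans (iso c₀) (Iso-sym (subst (λ w → Iso (H -ᵥ t) (H' -ᵥ w)) y≡u' (iso c)))))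
    by-cases (inj₂ (s' , fs'≡y)) = contradiction (begin
        true                         ≡⟨ universal (p (f s')) pfs'≢pfs ⟨
        adj H (p (f s)) (p (f s'))   ≡⟨ adj-p∘f s s' ⟩
        adj H' (f s) (f s')          ≡⟨ cong (adj H' (f s)) fs'≡y ⟩
        adj H' (f s) (deleted c)     ≡⟨ deficit⇒non-adjacent t≢px (universal t t≢px) deficit ⟩
        false                        ∎) λ ()
      where
      pfs'≢pfs : p (f s') ≢ p (f s)
      pfs'≢pfs eq = Card-deleted≢root c (trans (sym fs'≡y) (p-injective eq))

  ¬deficit : ∀ s → deg H (p (f s)) ≢ suc (deg H' (f s))
  ¬deficit s deficit with universal⊎non-neighbour H (p (f s))
  ... | inj₂ (t , t≢px , px≁t) = 1+n≰n (subst (_≤ deg H' (f s)) deficit (deg-H≤deg-H' t≢px px≁t))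
  ... | inj₁ universal with t , t≢px , ¬twin ← non-twin-avoiding H v (p (f s)) (H-cards-connected _) =
    universal⇒¬deficit s t≢px ¬twin universal deficit

  deg-difference : ∀ s {a b} → adj H' (f s) u' ≡ a → adj H (punchIn v s) v ≡ b →
                   toℕ b + deg H' (f s) ≡ toℕ a + deg H (p (f s))
  deg-difference s {a} {b} refl refl = begin
    toℕ b + deg H' (f s)        ≡⟨ cong (toℕ b +_) (Card-deg (f-Card s)) ⟩
    toℕ b + (toℕ a + deg G₀ s)  ≡⟨ x∙yz≈y∙xz (toℕ b) (toℕ a) _ ⟩
    toℕ a + (toℕ b + deg G₀ s)  ≡⟨ cong (toℕ a +_) (Card-deg (Card-self {K = H} v s)) ⟨
    toℕ a + deg H (punchIn v s) ≡⟨ cong (toℕ a +_) (deg-Twins H (p∘f-twin s)) ⟩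
    toℕ a + deg H (p (f s))     ∎
    where
    open ≡-Reasoning

  adj-f-u' : ∀ s → adj H' (f s) u' ≡ adj H (punchIn v s) v
  adj-f-u' s with adj H' (f s) u' in fs~u' | adj H (punchIn v s) v in w~v
  ... | true  | true  = refl
  ... | false | false = refl
  ... | true  | false = contradiction
          (subst (_≤ deg H (p (f s))) (deg-difference s fs~u' w~v) (deg-H'≤deg-H (f s))) 1+n≰n
  ... | false | true  = contradiction (sym (deg-difference s fs~u' w~v)) (¬deficit s)

  adj-p∘f-p-u' : ∀ s → adj H (p (f s)) (p u') ≡ adj H' (f s) u'
  adj-p∘f-p-u' s = trans (sym (adj-Twins H (p∘f-twin s) p-u'-twin)) (sym (adj-f-u' s))

  p-adj : ∀ a b → adj H (p a) (p b) ≡ adj H' a b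
  p-adj a b with f⊎u' a | f⊎u' b
  ... | inj₁ refl       | inj₁ refl       = trans (irrefl H (p u')) (sym (irrefl H' u'))
  ... | inj₂ (r , refl) | inj₂ (s , refl) = adj-p∘f r s
  ... | inj₂ (s , refl) | inj₁ refl       = adj-p∘f-p-u' s
  ... | inj₁ refl       | inj₂ (s , refl) =
    trans (Graph.sym H _ _) (trans (adj-p∘f-p-u' s) (Graph.sym H' _ _))

  H≅H' : Iso H H'
  H≅H' = Iso-sym (↔⇒Iso π p-adj)

iso-card⇒¬¬similar⊎pseudosimilar : ∀ {m} {H : Graph (suc m)} {v t} →
  Iso (H -ᵥ v) (H -ᵥ t) → ¬ ¬ (Similar H v t ⊎ Pseudosimilar H v t)
iso-card⇒¬¬similar⊎pseudosimilar I ¬sp = ¬sp (inj₂ (¬sp ∘ inj₁ , I))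

mainTheorem2 : {m : ℕ} (H : Graph (suc m)) (v : Fin (suc m)) →
    TwoConnected H →
    Rigid (H -ᵥ v) →
    ((∀ v' → ¬ v' ≡ v → ¬ (Similar H v v' ⊎ Pseudosimilar H v v'))
      ⊎ ((Σ (Fin (suc m)) λ v' → ¬ v' ≡ v × (Similar H v v' ⊎ Pseudosimilar H v v'))
         × (∀ v' → ¬ v' ≡ v → Similar H v v' ⊎ Pseudosimilar H v v' → Twins H v v'))) →
    (H' : Graph (suc m)) → SameGDD H H' → Iso H H'
mainTheorem2 {zero}        _ _ (s≤s () , _) _ _ _ _
mainTheorem2 {suc zero}    _ _ (s≤s (s≤s ()) , _) _ _ _ _
mainTheorem2 {suc (suc k)} H v (_ , H-connected , H-cards-connected) rigid hypothesis H' (π , same-gdeg) =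
  Reconstruction.H≅H' H H' v H-connected H-cards-connected rigid card-twin π same-gdeg
  where
  -- Only the second half of hypothesis (2) is needed.
  card-twin : ∀ t → Iso (H -ᵥ v) (H -ᵥ t) → Twins H v t
  card-twin t I with t ≟ v
  ... | yes refl = λ _ → refl
  ... | no t≢v   = [ (λ none → contradiction (none t t≢v) ¬¬similar⊎pseudosimilar)
                   , (λ (_ , only-twins) → decidable-stable (Twins? H v t)
                         (λ ¬twin → ¬¬similar⊎pseudosimilar (¬twin ∘ only-twins t t≢v))) ]′ hypothesis
    where
    ¬¬similar⊎pseudosimilar : ¬ ¬ (Similar H v t ⊎ Pseudosimilar H v t)
    ¬¬similar⊎pseudosimilar = iso-card⇒¬¬similar⊎pseudosimilar I
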